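{- Let $\alpha_3,\alpha_4\in\mathcal O_K$ be relatively prime in $\mathcal O_K$ with $\alpha_3\neq0$. For $\beta_1,\beta_2,\beta_1',\beta_2'\in\mathcal O_K$ we have $\mathcal L_{v(\beta_1,\beta_2)}=\mathcal L_{v(\beta_1',\beta_2')}$ if and only if $-\alpha_4\beta_1+\alpha_3\beta_2=-\alpha_4\beta_1'+\alpha_3\beta_2'$. In particular, $v(\beta_1,\beta_2)\in\mathcal L_{(0,1,0,1)}$ if and only if $(\beta_1,\beta_2)\in(0,1)+\mathcal O_K(\alpha_3,\alpha_4)$.
   Context: $\mathcal O_K=\mathbb{Z}[\sqrt2]$, $\sigma(a+b\sqrt2)=a-b\sqrt2$. For $\beta_1,\beta_2\in\mathcal O_K$ let $v(\beta_1,\beta_2)=(\beta_1,\beta_2,\sigma(\beta_1),\sigma(\beta_2))\in\mathbb{R}^4$. Let $v_1=(\alpha_3,\alpha_4,\sigma(\alpha_3),\sigma(\alpha_4))$, $v_2=(\sqrt2\alpha_3,\sqrt2\alpha_4,\sigma(\sqrt2\alpha_3),\sigma(\sqrt2\alpha_4))$, and for $v\in\mathbb{R}^4$ let $\mathcal L_v=v+\mathbb{Z}v_1+\mathbb{Z}v_2$. -}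

module Defs where

open import Data.Integer as ℤ using (ℤ; +_; 0ℤ; 1ℤ)
open import Data.Product using (_×_; _,_; ∃; ∃-syntax)
open import Relation.Binary.PropositionalEquality using (_≡_)
open import Relation.Nullary using (¬_)
open import Function.Bundles using (_⇔_)

-- O_K = ℤ[√2]; an element a + b√2 is recorded by its (unique) integer coordinates a, b.
record OK : Set where
  constructor _+_√2
  field
    re : ℤ
    im : ℤ
open OK public

infixl 6 _⊕_ _⊖_
infixl 7 _⊗_

_⊕_ : OK → OK → OK
(a + b √2) ⊕ (c + d √2) = (a ℤ.+ c) + (b ℤ.+ d) √2

⊖_ : OK → OK
⊖ (a + b √2) = (ℤ.- a) + (ℤ.- b) √2

_⊖_ : OK → OK → OK
x ⊖ y = x ⊕ (⊖ y)

_⊗_ : OK → OK → OK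
(a + b √2) ⊗ (c + d √2) = (a ℤ.* c ℤ.+ (+ 2) ℤ.* b ℤ.* d) + (a ℤ.* d ℤ.+ b ℤ.* c) √2

𝟘 𝟙 √2 : OK
𝟘 = 0ℤ + 0ℤ √2
𝟙 = 1ℤ + 0ℤ √2
√2 = 0ℤ + 1ℤ √2

σ : OK → OK
σ (a + b √2) = a + (ℤ.- b) √2

_∣K_ : OK → OK → Set
d ∣K x = ∃[ c ] c ⊗ d ≡ x

IsUnit : OK → Set
IsUnit u = ∃[ e ] u ⊗ e ≡ 𝟙

RelPrime : OK → OK → Set
RelPrime x y = ∀ d → d ∣K x → d ∣K y → IsUnit d

-- Points of ℝ⁴ with coordinates in ℤ[√2] ⊂ ℝ (the embedding ℤ[√2] → ℝ is injective,
-- so equality of such points coincides with equality in ℝ⁴).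
R4 : Set
R4 = OK × OK × OK × OK

_+ᵛ_ : R4 → R4 → R4
(a , b , c , d) +ᵛ (a' , b' , c' , d') = (a ⊕ a' , b ⊕ b' , c ⊕ c' , d ⊕ d')

_·ᵛ_ : ℤ → R4 → R4
n ·ᵛ (a , b , c , d) = let m = n + 0ℤ √2 in (m ⊗ a , m ⊗ b , m ⊗ c , m ⊗ d)

vv : OK → OK → R4
vv β₁ β₂ = (β₁ , β₂ , σ β₁ , σ β₂)

module Lattice (α₃ α₄ : OK) where
  v₁ v₂ : R4
  v₁ = vv α₃ α₄
  v₂ = vv (√2 ⊗ α₃) (√2 ⊗ α₄)

  _∈𝓛_ : R4 → R4 → Set
  x ∈𝓛 v = ∃[ n ] ∃[ m ] x ≡ (v +ᵛ (n ·ᵛ v₁)) +ᵛ (m ·ᵛ v₂)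

  -- equality of the sets 𝓛_v and 𝓛_w (all points of both lie in ℤ[√2]⁴)
  _≐𝓛_ : R4 → R4 → Set
  v ≐𝓛 w = ∀ x → (x ∈𝓛 v) ⇔ (x ∈𝓛 w)

{-# OPTIONS --safe #-}
-- ℤ[√2] is norm-Euclidean: to divide a by b ≠ 0 write a σ(b) = u + v√2, round u / N(b) and v / N(b)
-- to integers q₁, q₂ with remainders |sᵢ| ≤ |N(b)|/2, and put r = a − (q₁ + q₂√2) b; then
-- N(r) N(b) = N(r σ(b)) = s₁² − 2 s₂², which is smaller than N(b)² in absolute value.  (N(x) = 0 only
-- for x = 0, as √2 is irrational.)  The Euclidean algorithm gives p α₃ + q α₄ = 1 for coprime α₃, α₄.
--
-- Since n v₁ + m v₂ = v(γ α₃, γ α₄) for γ = n + m√2, the lattice 𝓛_{v(β)} consists of the points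
-- v(β + γ (α₃, α₄)) with γ ∈ 𝒪_K, so 𝓛_{v(β)} = 𝓛_{v(β')} iff β − β' ∈ 𝒪_K (α₃, α₄).  This module is
-- killed by (u, w) ↦ −α₄ u + α₃ w, and when p α₃ + q α₄ = 1 it is the whole kernel: a kernel element
-- (u, w) equals (p u + q w)(α₃, α₄).
module Submission where

open import Defs
open import Relation.Binary.PropositionalEquality
open import Algebra.Bundles using (CommutativeRing)
open import Algebra.Structures {A = OK} (_≡_)
open import Algebra.Definitions {A = OK} (_≡_)
open import Algebra.Consequences.Propositional {A = OK}
  using (comm∧idˡ⇒id; comm∧invˡ⇒inv; comm∧distrʳ⇒distrˡ)
open import Data.Integer as ℤ using (ℤ; +_; -[1+_]; 0ℤ; 1ℤ; ∣_∣)
import Data.Integer.Base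
open import Data.Integer.DivMod using (_/_; _%_; a≡a%n+[a/n]*n; n%d<d)
import Data.Integer.Properties as ℤₚ
import Data.Integer.Tactic.RingSolver as ℤ-Solver
open import Data.Maybe using (just; nothing)
open import Data.Nat as ℕ using (zero; suc; _≤_; _<_; z<s; s<s)
open import Data.Nat.DivMod using (m≡m%n+[m/n]*n; m%n<n; m/n*n≤m)
open import Data.Nat.Divisibility using (_∣_; divides; divides-refl)
open import Data.Nat.Induction using (<-wellFounded)
open import Data.Nat.Primality using (euclidsLemma; prime[2])
import Data.Nat.Properties as ℕₚ
import Data.Nat.Tactic.RingSolver as ℕ-Solver
open import Data.Product using (_×_; _,_; ∃-syntax; proj₁; proj₂)
open import Data.Sum using (inj₁; inj₂; [_,_]′)
open import Function using (id; _∘_)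
open import Function.Bundles using (_⇔_; mk⇔; Equivalence)
open import Function.Construct.Composition using (_⇔-∘_)
open import Induction.WellFounded using (Acc; acc)
open import Level using (0ℓ)
open import Relation.Nullary using (¬_; yes; no; contradiction)
import Tactic.RingSolver.Core.AlmostCommutativeRing as ACR

√2-ext : ∀ {a b c d} → a ≡ c → b ≡ d → a + b √2 ≡ c + d √2
√2-ext = cong₂ _+_√2

⊕-assoc : Associative _⊕_
⊕-assoc (a + b √2) (c + d √2) (e + f √2) = √2-ext (ℤₚ.+-assoc a c e) (ℤₚ.+-assoc b d f)

⊕-comm : Commutative _⊕_
⊕-comm (a + b √2) (c + d √2) = √2-ext (ℤₚ.+-comm a c) (ℤₚ.+-comm b d)

⊕-identityˡ : LeftIdentity 𝟘 _⊕_
⊕-identityˡ (a + b √2) = √2-ext (ℤₚ.+-identityˡ a) (ℤₚ.+-identityˡ b)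

⊖-inverseˡ : LeftInverse 𝟘 (⊖_) _⊕_
⊖-inverseˡ (a + b √2) = √2-ext (ℤₚ.+-inverseˡ a) (ℤₚ.+-inverseˡ b)

⊗-assoc : Associative _⊗_
⊗-assoc (a + b √2) (c + d √2) (e + f √2) = √2-ext (re-assoc a b c d e f) (im-assoc a b c d e f)
  where
  open Data.Integer.Base using (_+_; _*_)
  re-assoc : ∀ a b c d e f →
    (a * c + + 2 * b * d) * e + + 2 * (a * d + b * c) * f
      ≡ a * (c * e + + 2 * d * f) + + 2 * b * (c * f + d * e)
  re-assoc = ℤ-Solver.solve-∀
  im-assoc : ∀ a b c d e f →
    (a * c + + 2 * b * d) * f + (a * d + b * c) * e ≡ a * (c * f + d * e) + b * (c * e + + 2 * d * f)
  im-assoc = ℤ-Solver.solve-∀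

⊗-comm : Commutative _⊗_
⊗-comm (a + b √2) (c + d √2) = √2-ext (re-comm a b c d) (im-comm a b c d)
  where
  open Data.Integer.Base using (_+_; _*_)
  re-comm : ∀ a b c d → a * c + + 2 * b * d ≡ c * a + + 2 * d * b
  re-comm = ℤ-Solver.solve-∀
  im-comm : ∀ a b c d → a * d + b * c ≡ c * b + d * a
  im-comm = ℤ-Solver.solve-∀

⊗-identityˡ : LeftIdentity 𝟙 _⊗_
⊗-identityˡ (a + b √2) = √2-ext (re-id a b) (im-id a b)
  where
  open Data.Integer.Base using (_+_; _*_)
  re-id : ∀ a b → 1ℤ * a + + 2 * 0ℤ * b ≡ a
  re-id = ℤ-Solver.solve-∀
  im-id : ∀ a b → 1ℤ * b + 0ℤ * a ≡ b
  im-id = ℤ-Solver.solve-∀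

⊗-distribʳ-⊕ : _⊗_ DistributesOverʳ _⊕_
⊗-distribʳ-⊕ (a + b √2) (c + d √2) (e + f √2) = √2-ext (re-distrib a b c d e f) (im-distrib a b c d e f)
  where
  open Data.Integer.Base using (_+_; _*_)
  re-distrib : ∀ a b c d e f →
    (c + e) * a + + 2 * (d + f) * b ≡ (c * a + + 2 * d * b) + (e * a + + 2 * f * b)
  re-distrib = ℤ-Solver.solve-∀
  im-distrib : ∀ a b c d e f → (c + e) * b + (d + f) * a ≡ (c * b + d * a) + (e * b + f * a)
  im-distrib = ℤ-Solver.solve-∀

⊕-⊗-isCommutativeRing : IsCommutativeRing _⊕_ _⊗_ (⊖_) 𝟘 𝟙
⊕-⊗-isCommutativeRing = record
  { isRing = record
    { +-isAbelianGroup = record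
      { isGroup = record
        { isMonoid = record
          { isSemigroup = record
            { isMagma = record { isEquivalence = isEquivalence ; ∙-cong = cong₂ _⊕_ }
            ; assoc = ⊕-assoc
            }
          ; identity = comm∧idˡ⇒id ⊕-comm ⊕-identityˡ
          }
        ; inverse = comm∧invˡ⇒inv ⊕-comm ⊖-inverseˡ
        ; ⁻¹-cong = cong (⊖_)
        }
      ; comm = ⊕-comm
      }
    ; *-cong = cong₂ _⊗_
    ; *-assoc = ⊗-assoc
    ; *-identity = comm∧idˡ⇒id ⊗-comm ⊗-identityˡ
    ; distrib = comm∧distrʳ⇒distrˡ ⊗-comm ⊗-distribʳ-⊕ , ⊗-distribʳ-⊕
    }
  ; *-comm = ⊗-comm
  }

⊕-⊗-commutativeRing : CommutativeRing 0ℓ 0ℓ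
⊕-⊗-commutativeRing = record { isCommutativeRing = ⊕-⊗-isCommutativeRing }

⊕-⊗-almostCommutativeRing : ACR.AlmostCommutativeRing 0ℓ 0ℓ
⊕-⊗-almostCommutativeRing = ACR.fromCommutativeRing ⊕-⊗-commutativeRing λ
  { ((+ zero) + (+ zero) √2) → just refl
  ; _ → nothing }

open import Tactic.RingSolver.NonReflective ⊕-⊗-almostCommutativeRing
  using (solve; _⊜_; Expr; Κ; ⊝_) renaming (_⊕_ to _:+_; _⊗_ to _:*_)

infixl 6 _:-_
_:-_ : ∀ {n} → Expr OK n → Expr OK n → Expr OK n
x :- y = x :+ ⊝ y

fromℤ : ℤ → OK
fromℤ n = n + 0ℤ √2

+√2≡fromℤ⊕fromℤ⊗√2 : ∀ n m → n + m √2 ≡ fromℤ n ⊕ fromℤ m ⊗ √2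
+√2≡fromℤ⊕fromℤ⊗√2 n m = √2-ext (re-decomp n m) (im-decomp n m)
  where
  open Data.Integer.Base using (_+_; _*_)
  re-decomp : ∀ n m → n ≡ n + (m * 0ℤ + + 2 * 0ℤ * 1ℤ)
  re-decomp = ℤ-Solver.solve-∀
  im-decomp : ∀ n m → m ≡ 0ℤ + (m * 1ℤ + 0ℤ * 0ℤ)
  im-decomp = ℤ-Solver.solve-∀

σ-⊕ : ∀ x y → σ (x ⊕ y) ≡ σ x ⊕ σ y
σ-⊕ (a + b √2) (c + d √2) = cong ((a ℤ.+ c) +_√2) (ℤₚ.neg-distrib-+ b d)

σ-⊗ : ∀ x y → σ (x ⊗ y) ≡ σ x ⊗ σ y
σ-⊗ (a + b √2) (c + d √2) = √2-ext (re-σ a b c d) (im-σ a b c d)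
  where
  open Data.Integer.Base using (_+_; _*_; -_)
  re-σ : ∀ a b c d → a * c + + 2 * b * d ≡ a * c + + 2 * (- b) * (- d)
  re-σ = ℤ-Solver.solve-∀
  im-σ : ∀ a b c d → - (a * d + b * c) ≡ a * (- d) + (- b) * c
  im-σ = ℤ-Solver.solve-∀

norm : OK → ℤ
norm (a + b √2) = a ℤ.* a ℤ.- + 2 ℤ.* (b ℤ.* b)

norm-⊗ : ∀ x y → norm (x ⊗ y) ≡ norm x ℤ.* norm y
norm-⊗ (a + b √2) (c + d √2) = multiplicative a b c d
  where
  open Data.Integer.Base using (_+_; _*_; _-_)
  multiplicative : ∀ a b c d →
    (a * c + + 2 * b * d) * (a * c + + 2 * b * d) - + 2 * ((a * d + b * c) * (a * d + b * c))
      ≡ (a * a - + 2 * (b * b)) * (c * c - + 2 * (d * d))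
  multiplicative = ℤ-Solver.solve-∀

norm-σ : ∀ x → norm (σ x) ≡ norm x
norm-σ (a + b √2) = conjugate-invariant a b
  where
  open Data.Integer.Base using (_*_; _-_; -_)
  conjugate-invariant : ∀ a b → a * a - + 2 * (- b * - b) ≡ a * a - + 2 * (b * b)
  conjugate-invariant = ℤ-Solver.solve-∀

⊗-σ : ∀ x → x ⊗ σ x ≡ fromℤ (norm x)
⊗-σ (a + b √2) = √2-ext (re-σ a b) (im-σ a b)
  where
  open Data.Integer.Base using (_+_; _*_; _-_; -_)
  re-σ : ∀ a b → a * a + + 2 * b * (- b) ≡ a * a - + 2 * (b * b)
  re-σ = ℤ-Solver.solve-∀
  im-σ : ∀ a b → a * (- b) + b * a ≡ 0ℤ
  im-σ = ℤ-Solver.solve-∀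

2∣m*m⇒2∣m : ∀ m → 2 ∣ m ℕ.* m → 2 ∣ m
2∣m*m⇒2∣m m 2∣m*m = [ id , id ]′ (euclidsLemma m m prime[2] 2∣m*m)

m*m≡2*n*n⇒m≡2k : ∀ m n → m ℕ.* m ≡ 2 ℕ.* (n ℕ.* n) →
  ∃[ k ] m ≡ k ℕ.* 2 × n ℕ.* n ≡ 2 ℕ.* (k ℕ.* k)
m*m≡2*n*n⇒m≡2k m n m²≡2n² with 2∣m*m⇒2∣m m (divides (n ℕ.* n) (trans m²≡2n² (ℕₚ.*-comm 2 (n ℕ.* n))))
... | divides-refl k = k , refl , sym (ℕₚ.*-cancelˡ-≡ _ _ 2 (trans (sym ([2k]²≡2*2k² k)) m²≡2n²))
  where
  [2k]²≡2*2k² : ∀ k → k ℕ.* 2 ℕ.* (k ℕ.* 2) ≡ 2 ℕ.* (2 ℕ.* (k ℕ.* k))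
  [2k]²≡2*2k² = ℕ-Solver.solve-∀

m*m≡2*n*n⇒n≡0 : ∀ m n → m ℕ.* m ≡ 2 ℕ.* (n ℕ.* n) → n ≡ 0
m*m≡2*n*n⇒n≡0 m n = descent m n (<-wellFounded n)
  where
  descent : ∀ m n → Acc _<_ n → m ℕ.* m ≡ 2 ℕ.* (n ℕ.* n) → n ≡ 0
  descent m n (acc rec) m²≡2n² with m*m≡2*n*n⇒m≡2k m n m²≡2n²
  ... | k , refl , n²≡2k² with m*m≡2*n*n⇒m≡2k n k n²≡2k²
  ...   | zero , refl , _ = refl
  ...   | j@(suc _) , refl , k²≡2j² =
    contradiction (descent k j (rec (ℕₚ.m<m*n j 2 (s<s z<s))) k²≡2j²) λ ()

norm≡0⇒≡𝟘 : ∀ x → norm x ≡ 0ℤ → x ≡ 𝟘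
norm≡0⇒≡𝟘 (a + b √2) Nx≡0 = √2-ext (ℤₚ.∣i∣≡0⇒i≡0 ∣a∣≡0) (ℤₚ.∣i∣≡0⇒i≡0 ∣b∣≡0)
  where
  open ≡-Reasoning
  ∣a∣²≡2∣b∣² : ∣ a ∣ ℕ.* ∣ a ∣ ≡ 2 ℕ.* (∣ b ∣ ℕ.* ∣ b ∣)
  ∣a∣²≡2∣b∣² = begin
    ∣ a ∣ ℕ.* ∣ a ∣            ≡⟨ ℤₚ.abs-* a a ⟨
    ∣ a ℤ.* a ∣               ≡⟨ cong ∣_∣ (ℤₚ.i-j≡0⇒i≡j (a ℤ.* a) (+ 2 ℤ.* (b ℤ.* b)) Nx≡0) ⟩
    ∣ + 2 ℤ.* (b ℤ.* b) ∣     ≡⟨ ℤₚ.abs-* (+ 2) (b ℤ.* b) ⟩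
    2 ℕ.* ∣ b ℤ.* b ∣         ≡⟨ cong (2 ℕ.*_) (ℤₚ.abs-* b b) ⟩
    2 ℕ.* (∣ b ∣ ℕ.* ∣ b ∣)    ∎
  ∣b∣≡0 = m*m≡2*n*n⇒n≡0 ∣ a ∣ ∣ b ∣ ∣a∣²≡2∣b∣²
  ∣a∣≡0 = [ id , id ]′ (ℕₚ.m*n≡0⇒m≡0∨n≡0 ∣ a ∣ (trans ∣a∣²≡2∣b∣² (cong (λ t → 2 ℕ.* (t ℕ.* t)) ∣b∣≡0)))

centred-remainder : ∀ {r d} → r < d → 2 ℕ.* ∣ r ℤ.⊖ d ℕ./ 2 ∣ ≤ d
centred-remainder {r} {d} r<d = begin
  2 ℕ.* ∣ r ℤ.⊖ h ∣ ≤⟨ ℕₚ.*-monoʳ-≤ 2 ∣r⊖h∣≤h ⟩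
  2 ℕ.* h           ≡⟨ ℕₚ.*-comm 2 h ⟩
  h ℕ.* 2           ≤⟨ m/n*n≤m d 2 ⟩
  d                 ∎
  where
  open ℕₚ.≤-Reasoning
  h = d ℕ./ 2
  twice : ∀ h → h ℕ.* 2 ≡ h ℕ.+ h
  twice = ℕ-Solver.solve-∀
  r≤h+h : r ≤ h ℕ.+ h
  r≤h+h = ℕₚ.≤-pred (begin
    suc r                   ≤⟨ r<d ⟩
    d                       ≡⟨ m≡m%n+[m/n]*n d 2 ⟩
    d ℕ.% 2 ℕ.+ h ℕ.* 2     ≤⟨ ℕₚ.+-monoˡ-≤ (h ℕ.* 2) (ℕₚ.≤-pred (m%n<n d 2)) ⟩
    suc (h ℕ.* 2)           ≡⟨ cong suc (twice h) ⟩
    suc (h ℕ.+ h)           ∎)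
  ∣r⊖h∣≤h : ∣ r ℤ.⊖ h ∣ ≤ h
  ∣r⊖h∣≤h with ℕₚ.≤-total r h
  ... | inj₁ r≤h = ℕₚ.≤-trans (ℕₚ.≤-reflexive (ℤₚ.∣⊖∣-≤ r≤h)) (ℕₚ.m∸n≤m h r)
  ... | inj₂ h≤r = ℕₚ.≤-trans (ℕₚ.≤-reflexive (trans (ℤₚ.∣m⊖n∣≡∣n⊖m∣ r h) (ℤₚ.∣⊖∣-≤ h≤r)))
                             (ℕₚ.m≤n+o⇒m∸n≤o r h r≤h+h)

-- Rounding u + ⌊|n|/2⌋ down to a multiple of n rounds u to the nearest multiple.
nearest-multiple : ∀ u n .{{_ : ℤ.NonZero n}} →
  ∃[ q ] ∃[ s ] u ≡ q ℤ.* n ℤ.+ s × 2 ℕ.* ∣ s ∣ ≤ ∣ n ∣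
nearest-multiple u n = q , + r ℤ.- + h , u≡qn+s , small
  where
  open ≡-Reasoning
  open Data.Integer.Base using (_+_; _*_; _-_)
  h = ∣ n ∣ ℕ./ 2
  q = (u + + h) / n
  r = (u + + h) % n
  shift : ∀ u h → u ≡ (u + h) - h
  shift = ℤ-Solver.solve-∀
  unshift : ∀ r x h → (r + x) - h ≡ x + (r - h)
  unshift = ℤ-Solver.solve-∀
  u≡qn+s : u ≡ q * n + (+ r - + h)
  u≡qn+s = begin
    u                 ≡⟨ shift u (+ h) ⟩
    (u + + h) - + h   ≡⟨ cong (_- + h) (a≡a%n+[a/n]*n (u + + h) n) ⟩
    (+ r + q * n) - + h ≡⟨ unshift (+ r) (q * n) (+ h) ⟩
    q * n + (+ r - + h) ∎
  small : 2 ℕ.* ∣ + r - + h ∣ ≤ ∣ n ∣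
  small rewrite ℤₚ.m-n≡m⊖n r h = centred-remainder (n%d<d (u + + h) n)

2*m≤n⇒m<n : ∀ {m n} → 0 < n → 2 ℕ.* m ≤ n → m < n
2*m≤n⇒m<n {zero}  0<n _    = 0<n
2*m≤n⇒m<n {m@(suc _)} {n} _ 2m≤n =
  ℕₚ.<-≤-trans (ℕₚ.m<m*n m 2 (s<s z<s)) (subst (_≤ n) (ℕₚ.*-comm 2 m) 2m≤n)

i*i≡∣i∣*∣i∣ : ∀ i → i ℤ.* i ≡ + (∣ i ∣ ℕ.* ∣ i ∣)
i*i≡∣i∣*∣i∣ (+ n)    = sym (ℤₚ.pos-* n n)
i*i≡∣i∣*∣i∣ -[1+ n ] = refl

small-norm : ∀ s₁ s₂ {d} → 0 < d → 2 ℕ.* ∣ s₁ ∣ ≤ d → 2 ℕ.* ∣ s₂ ∣ ≤ d →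
  ∣ norm (s₁ + s₂ √2) ∣ < d ℕ.* d
small-norm s₁ s₂ {d} 0<d 2A≤d 2B≤d = ℕₚ.≤-<-trans ∣A²⊖2B²∣≤A²⊔2B² (ℕₚ.⊔-lub A²<d² 2B²<d²)
  where
  A = ∣ s₁ ∣
  B = ∣ s₂ ∣
  norm≡A²⊖2B² : norm (s₁ + s₂ √2) ≡ (A ℕ.* A) ℤ.⊖ (2 ℕ.* (B ℕ.* B))
  norm≡A²⊖2B² = trans (cong₂ (λ x y → x ℤ.- + 2 ℤ.* y) (i*i≡∣i∣*∣i∣ s₁) (i*i≡∣i∣*∣i∣ s₂))
                      (trans (cong (λ y → + (A ℕ.* A) ℤ.- y) (sym (ℤₚ.pos-* 2 (B ℕ.* B))))
                             (ℤₚ.m-n≡m⊖n (A ℕ.* A) (2 ℕ.* (B ℕ.* B))))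
  ∣A²⊖2B²∣≤A²⊔2B² : ∣ norm (s₁ + s₂ √2) ∣ ≤ A ℕ.* A ℕ.⊔ 2 ℕ.* (B ℕ.* B)
  ∣A²⊖2B²∣≤A²⊔2B² rewrite norm≡A²⊖2B² = ℤₚ.∣m⊝n∣≤m⊔n (A ℕ.* A) (2 ℕ.* (B ℕ.* B))
  A<d : A < d
  A<d = 2*m≤n⇒m<n 0<d 2A≤d
  A²<d² : A ℕ.* A < d ℕ.* d
  A²<d² = ℕₚ.*-mono-< A<d A<d
  [2B]²≡2*2B² : ∀ B → 2 ℕ.* B ℕ.* (2 ℕ.* B) ≡ 2 ℕ.* (2 ℕ.* (B ℕ.* B))
  [2B]²≡2*2B² = ℕ-Solver.solve-∀
  2B²<d² : 2 ℕ.* (B ℕ.* B) < d ℕ.* d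
  2B²<d² = 2*m≤n⇒m<n {2 ℕ.* (B ℕ.* B)} (ℕₚ.*-mono-< 0<d 0<d)
    (ℕₚ.≤-trans (ℕₚ.≤-reflexive (sym ([2B]²≡2*2B² B))) (ℕₚ.*-mono-≤ 2B≤d 2B≤d))

⊗-fromℤ-⊕ : ∀ q₁ q₂ n s₁ s₂ →
  (q₁ + q₂ √2) ⊗ fromℤ n ⊕ (s₁ + s₂ √2) ≡ (q₁ ℤ.* n ℤ.+ s₁) + (q₂ ℤ.* n ℤ.+ s₂) √2
⊗-fromℤ-⊕ q₁ q₂ n s₁ s₂ = √2-ext (re-scale q₁ q₂ n s₁) (im-scale q₁ q₂ n s₂)
  where
  open Data.Integer.Base using (_+_; _*_)
  re-scale : ∀ q₁ q₂ n s₁ → q₁ * n + + 2 * q₂ * 0ℤ + s₁ ≡ q₁ * n + s₁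
  re-scale = ℤ-Solver.solve-∀
  im-scale : ∀ q₁ q₂ n s₂ → q₁ * 0ℤ + q₂ * n + s₂ ≡ q₂ * n + s₂
  im-scale = ℤ-Solver.solve-∀

euclidean-division : ∀ a b → norm b ≢ 0ℤ →
  ∃[ q ] ∃[ r ] a ≡ q ⊗ b ⊕ r × ∣ norm r ∣ < ∣ norm b ∣
euclidean-division a b Nb≢0
  with nearest-multiple (re (a ⊗ σ b)) (norm b) {{ℤ.≢-nonZero Nb≢0}}
     | nearest-multiple (im (a ⊗ σ b)) (norm b) {{ℤ.≢-nonZero Nb≢0}}
... | q₁ , s₁ , re≡ , s₁-small | q₂ , s₂ , im≡ , s₂-small =
  q , r , a≡qb+r a q b , ℕₚ.*-cancelʳ-< _ _ _ ∣Nr∣*∣Nb∣<∣Nb∣*∣Nb∣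
  where
  n = norm b
  q = q₁ + q₂ √2
  s = s₁ + s₂ √2
  r = a ⊖ q ⊗ b
  a≡qb+r : ∀ a q b → a ≡ q ⊗ b ⊕ (a ⊖ q ⊗ b)
  a≡qb+r = solve 3 (λ a q b → a ⊜ (q :* b :+ (a :- q :* b))) refl
  distribute : ∀ a q b c → (a ⊖ q ⊗ b) ⊗ c ≡ a ⊗ c ⊖ q ⊗ (b ⊗ c)
  distribute = solve 4 (λ a q b c → ((a :- q :* b) :* c) ⊜ (a :* c :- q :* (b :* c))) refl
  cancel : ∀ x y → (x ⊕ y) ⊖ x ≡ y
  cancel = solve 2 (λ x y → ((x :+ y) :- x) ⊜ y) refl
  rσb≡s : r ⊗ σ b ≡ s
  aσb≡qn+s : a ⊗ σ b ≡ q ⊗ fromℤ n ⊕ s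
  aσb≡qn+s = trans (√2-ext re≡ im≡) (sym (⊗-fromℤ-⊕ q₁ q₂ n s₁ s₂))
  rσb≡s = begin
    r ⊗ σ b                        ≡⟨ distribute a q b (σ b) ⟩
    a ⊗ σ b ⊖ q ⊗ (b ⊗ σ b)        ≡⟨ cong₂ (λ x y → x ⊖ q ⊗ y) aσb≡qn+s (⊗-σ b) ⟩
    (q ⊗ fromℤ n ⊕ s) ⊖ q ⊗ fromℤ n ≡⟨ cancel (q ⊗ fromℤ n) s ⟩
    s                              ∎
    where open ≡-Reasoning
  Nr*Nb≡Ns : norm r ℤ.* n ≡ norm s
  Nr*Nb≡Ns = begin
    norm r ℤ.* n         ≡⟨ cong (norm r ℤ.*_) (sym (norm-σ b)) ⟩
    norm r ℤ.* norm (σ b) ≡⟨ sym (norm-⊗ r (σ b)) ⟩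
    norm (r ⊗ σ b)       ≡⟨ cong norm rσb≡s ⟩
    norm s               ∎
    where open ≡-Reasoning
  ∣Nr∣*∣Nb∣<∣Nb∣*∣Nb∣ : ∣ norm r ∣ ℕ.* ∣ n ∣ < ∣ n ∣ ℕ.* ∣ n ∣
  ∣Nr∣*∣Nb∣<∣Nb∣*∣Nb∣ = begin-strict
    ∣ norm r ∣ ℕ.* ∣ n ∣ ≡⟨ sym (ℤₚ.abs-* (norm r) n) ⟩
    ∣ norm r ℤ.* n ∣    ≡⟨ cong ∣_∣ Nr*Nb≡Ns ⟩
    ∣ norm s ∣          <⟨ small-norm s₁ s₂ (ℕₚ.n≢0⇒n>0 (Nb≢0 ∘ ℤₚ.∣i∣≡0⇒i≡0)) s₁-small s₂-small ⟩
    ∣ n ∣ ℕ.* ∣ n ∣      ∎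
    where open ℕₚ.≤-Reasoning

record Bézout (a b : OK) : Set where
  constructor bézout
  field
    d : OK
    d∣a : d ∣K a
    d∣b : d ∣K b
    x y : OK
    xa+yb≡d : x ⊗ a ⊕ y ⊗ b ≡ d

bézout-𝟘 : ∀ a → Bézout a 𝟘
bézout-𝟘 a = bézout a (𝟙 , ⊗-identityˡ a) (𝟘 , 𝟘a≡𝟘 a) 𝟙 𝟘 (𝟙a+𝟘𝟘≡a a)
  where
  𝟘a≡𝟘 : ∀ a → 𝟘 ⊗ a ≡ 𝟘
  𝟘a≡𝟘 = solve 1 (λ a → (Κ 𝟘 :* a) ⊜ Κ 𝟘) refl
  𝟙a+𝟘𝟘≡a : ∀ a → 𝟙 ⊗ a ⊕ 𝟘 ⊗ 𝟘 ≡ a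
  𝟙a+𝟘𝟘≡a = solve 1 (λ a → (Κ 𝟙 :* a :+ Κ 𝟘 :* Κ 𝟘) ⊜ a) refl

bézout-step : ∀ {a b} q r → a ≡ q ⊗ b ⊕ r → Bézout b r → Bézout a b
bézout-step q r refl (bézout d (c , refl) (c' , refl) x y xb+yr≡d) =
  bézout d (q ⊗ c ⊕ c' , divisor q c c' d) (c , refl) y (x ⊖ y ⊗ q)
    (trans (combination x y q (c ⊗ d) (c' ⊗ d)) xb+yr≡d)
  where
  divisor : ∀ q c c' d → (q ⊗ c ⊕ c') ⊗ d ≡ q ⊗ (c ⊗ d) ⊕ c' ⊗ d
  divisor = solve 4 (λ q c c' d → ((q :* c :+ c') :* d) ⊜ (q :* (c :* d) :+ c' :* d)) refl
  combination : ∀ x y q b r → y ⊗ (q ⊗ b ⊕ r) ⊕ (x ⊖ y ⊗ q) ⊗ b ≡ x ⊗ b ⊕ y ⊗ r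
  combination = solve 5 (λ x y q b r →
    (y :* (q :* b :+ r) :+ (x :- y :* q) :* b) ⊜ (x :* b :+ y :* r)) refl

bézout-identity : ∀ a b → Bézout a b
bézout-identity a b = euclid a b (<-wellFounded ∣ norm b ∣)
  where
  euclid : ∀ a b → Acc _<_ ∣ norm b ∣ → Bézout a b
  euclid a b (acc rec) with norm b ℤ.≟ 0ℤ
  ... | yes Nb≡0 = subst (Bézout a) (sym (norm≡0⇒≡𝟘 b Nb≡0)) (bézout-𝟘 a)
  ... | no Nb≢0 =
    let q , r , a≡qb+r , Nr<Nb = euclidean-division a b Nb≢0
    in bézout-step q r a≡qb+r (euclid b r (rec Nr<Nb))

relPrime⇒xa+yb≡𝟙 : ∀ a b → RelPrime a b → ∃[ x ] ∃[ y ] x ⊗ a ⊕ y ⊗ b ≡ 𝟙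
relPrime⇒xa+yb≡𝟙 a b coprime with bézout-identity a b
... | bézout d d∣a d∣b x y xa+yb≡d with coprime d d∣a d∣b
... | e , de≡𝟙 = e ⊗ x , e ⊗ y , (begin
  (e ⊗ x) ⊗ a ⊕ (e ⊗ y) ⊗ b ≡⟨ factor e x a y b ⟩
  (x ⊗ a ⊕ y ⊗ b) ⊗ e       ≡⟨ cong (_⊗ e) xa+yb≡d ⟩
  d ⊗ e                     ≡⟨ de≡𝟙 ⟩
  𝟙                         ∎)
  where
  open ≡-Reasoning
  factor : ∀ e x a y b → (e ⊗ x) ⊗ a ⊕ (e ⊗ y) ⊗ b ≡ (x ⊗ a ⊕ y ⊗ b) ⊗ e
  factor = solve 5 (λ e x a y b → ((e :* x) :* a :+ (e :* y) :* b) ⊜ ((x :* a :+ y :* b) :* e)) refl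

det≡𝟘⇒proportional : ∀ p q a b u w → p ⊗ a ⊕ q ⊗ b ≡ 𝟙 → (⊖ b) ⊗ u ⊕ a ⊗ w ≡ 𝟘 →
  u ≡ (p ⊗ u ⊕ q ⊗ w) ⊗ a × w ≡ (p ⊗ u ⊕ q ⊗ w) ⊗ b
det≡𝟘⇒proportional p q a b u w pa+qb≡𝟙 det≡𝟘 = u≡γa , w≡γb
  where
  open ≡-Reasoning
  pad₁ : ∀ u q → u ≡ u ⊗ 𝟙 ⊕ q ⊗ 𝟘
  pad₁ = solve 2 (λ u q → u ⊜ (u :* Κ 𝟙 :+ q :* Κ 𝟘)) refl
  pad₂ : ∀ w p → w ≡ w ⊗ 𝟙 ⊖ p ⊗ 𝟘
  pad₂ = solve 2 (λ w p → w ⊜ (w :* Κ 𝟙 :- p :* Κ 𝟘)) refl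
  expand₁ : ∀ p q a b u w → u ⊗ (p ⊗ a ⊕ q ⊗ b) ⊕ q ⊗ ((⊖ b) ⊗ u ⊕ a ⊗ w) ≡ (p ⊗ u ⊕ q ⊗ w) ⊗ a
  expand₁ = solve 6 (λ p q a b u w →
    (u :* (p :* a :+ q :* b) :+ q :* ((⊝ b) :* u :+ a :* w)) ⊜ ((p :* u :+ q :* w) :* a)) refl
  expand₂ : ∀ p q a b u w → w ⊗ (p ⊗ a ⊕ q ⊗ b) ⊖ p ⊗ ((⊖ b) ⊗ u ⊕ a ⊗ w) ≡ (p ⊗ u ⊕ q ⊗ w) ⊗ b
  expand₂ = solve 6 (λ p q a b u w →
    (w :* (p :* a :+ q :* b) :- p :* ((⊝ b) :* u :+ a :* w)) ⊜ ((p :* u :+ q :* w) :* b)) refl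
  u≡γa : u ≡ (p ⊗ u ⊕ q ⊗ w) ⊗ a
  u≡γa = begin
    u                                                ≡⟨ pad₁ u q ⟩
    u ⊗ 𝟙 ⊕ q ⊗ 𝟘                                    ≡⟨ cong₂ (λ s t → u ⊗ s ⊕ q ⊗ t) pa+qb≡𝟙 det≡𝟘 ⟨
    u ⊗ (p ⊗ a ⊕ q ⊗ b) ⊕ q ⊗ ((⊖ b) ⊗ u ⊕ a ⊗ w)    ≡⟨ expand₁ p q a b u w ⟩
    (p ⊗ u ⊕ q ⊗ w) ⊗ a                              ∎
  w≡γb : w ≡ (p ⊗ u ⊕ q ⊗ w) ⊗ b
  w≡γb = begin
    w                                                ≡⟨ pad₂ w p ⟩
    w ⊗ 𝟙 ⊖ p ⊗ 𝟘                                    ≡⟨ cong₂ (λ s t → w ⊗ s ⊖ p ⊗ t) pa+qb≡𝟙 det≡𝟘 ⟨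
    w ⊗ (p ⊗ a ⊕ q ⊗ b) ⊖ p ⊗ ((⊖ b) ⊗ u ⊕ a ⊗ w)    ≡⟨ expand₂ p q a b u w ⟩
    (p ⊗ u ⊕ q ⊗ w) ⊗ b                              ∎

σ-translate : ∀ β α c n m →
  σ ((β ⊕ fromℤ n ⊗ α) ⊕ fromℤ m ⊗ c) ≡ (σ β ⊕ fromℤ n ⊗ σ α) ⊕ fromℤ m ⊗ σ c
σ-translate β α c n m = begin
  σ ((β ⊕ fromℤ n ⊗ α) ⊕ fromℤ m ⊗ c)        ≡⟨ σ-⊕ (β ⊕ fromℤ n ⊗ α) (fromℤ m ⊗ c) ⟩
  σ (β ⊕ fromℤ n ⊗ α) ⊕ σ (fromℤ m ⊗ c)      ≡⟨ cong₂ _⊕_ (σ-⊕ β (fromℤ n ⊗ α)) (σ-⊗ (fromℤ m) c) ⟩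
  (σ β ⊕ σ (fromℤ n ⊗ α)) ⊕ fromℤ m ⊗ σ c    ≡⟨ cong (λ t → (σ β ⊕ t) ⊕ fromℤ m ⊗ σ c) (σ-⊗ (fromℤ n) α) ⟩
  (σ β ⊕ fromℤ n ⊗ σ α) ⊕ fromℤ m ⊗ σ c      ∎
  where open ≡-Reasoning

translate : ∀ β α c i j → (β ⊕ i ⊗ α) ⊕ j ⊗ (c ⊗ α) ≡ β ⊕ (i ⊕ j ⊗ c) ⊗ α
translate = solve 5 (λ β α c i j → ((β :+ i :* α) :+ j :* (c :* α)) ⊜ (β :+ (i :+ j :* c) :* α)) refl

module _ (α₃ α₄ : OK) where
  open Lattice α₃ α₄

  _≋_ : OK × OK → OK × OK → Set
  (β₁ , β₂) ≋ (β₁' , β₂') = ∃[ γ ] (β₁ ≡ β₁' ⊕ γ ⊗ α₃ × β₂ ≡ β₂' ⊕ γ ⊗ α₄)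

  det : OK × OK → OK
  det (β₁ , β₂) = (⊖ α₄) ⊗ β₁ ⊕ α₃ ⊗ β₂

  ≋-refl : ∀ β → β ≋ β
  ≋-refl (β₁ , β₂) = 𝟘 , shift-𝟘 β₁ α₃ , shift-𝟘 β₂ α₄
    where
    shift-𝟘 : ∀ β α → β ≡ β ⊕ 𝟘 ⊗ α
    shift-𝟘 = solve 2 (λ β α → β ⊜ (β :+ Κ 𝟘 :* α)) refl

  ≋-sym : ∀ β β' → β ≋ β' → β' ≋ β
  ≋-sym _ (β₁' , β₂') (γ , refl , refl) = ⊖ γ , unshift β₁' γ α₃ , unshift β₂' γ α₄
    where
    unshift : ∀ β γ α → β ≡ (β ⊕ γ ⊗ α) ⊕ (⊖ γ) ⊗ α
    unshift = solve 3 (λ β γ α → β ⊜ ((β :+ γ :* α) :+ (⊝ γ) :* α)) refl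

  ≋-trans : ∀ β β' β'' → β ≋ β' → β' ≋ β'' → β ≋ β''
  ≋-trans _ _ (β₁'' , β₂'') (γ , refl , refl) (γ' , refl , refl) =
    γ' ⊕ γ , shift-shift β₁'' γ' γ α₃ , shift-shift β₂'' γ' γ α₄
    where
    shift-shift : ∀ β γ' γ α → (β ⊕ γ' ⊗ α) ⊕ γ ⊗ α ≡ β ⊕ (γ' ⊕ γ) ⊗ α
    shift-shift = solve 4 (λ β γ' γ α → ((β :+ γ' :* α) :+ γ :* α) ⊜ (β :+ (γ' :+ γ) :* α)) refl

  ≋⇒det≡ : ∀ β β' → β ≋ β' → det β ≡ det β'
  ≋⇒det≡ _ (β₁' , β₂') (γ , refl , refl) = det-invariant α₃ α₄ β₁' β₂' γ
    where
    det-invariant : ∀ a b β₁ β₂ γ → (⊖ b) ⊗ (β₁ ⊕ γ ⊗ a) ⊕ a ⊗ (β₂ ⊕ γ ⊗ b) ≡ (⊖ b) ⊗ β₁ ⊕ a ⊗ β₂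
    det-invariant = solve 5 (λ a b β₁ β₂ γ →
      ((⊝ b) :* (β₁ :+ γ :* a) :+ a :* (β₂ :+ γ :* b)) ⊜ ((⊝ b) :* β₁ :+ a :* β₂)) refl

  det≡⇒≋ : ∀ p q β β' → p ⊗ α₃ ⊕ q ⊗ α₄ ≡ 𝟙 → det β ≡ det β' → β ≋ β'
  det≡⇒≋ p q (β₁ , β₂) (β₁' , β₂') pα₃+qα₄≡𝟙 det≡ =
    p ⊗ (β₁ ⊖ β₁') ⊕ q ⊗ (β₂ ⊖ β₂') ,
    trans (split β₁ β₁') (cong (β₁' ⊕_) u≡γα₃) ,
    trans (split β₂ β₂') (cong (β₂' ⊕_) w≡γα₄)
    where
    split : ∀ β β' → β ≡ β' ⊕ (β ⊖ β')
    split = solve 2 (λ β β' → β ⊜ (β' :+ (β :- β'))) refl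
    det-difference : ∀ a b β₁ β₂ β₁' β₂' →
      (⊖ b) ⊗ (β₁ ⊖ β₁') ⊕ a ⊗ (β₂ ⊖ β₂') ≡ ((⊖ b) ⊗ β₁ ⊕ a ⊗ β₂) ⊖ ((⊖ b) ⊗ β₁' ⊕ a ⊗ β₂')
    det-difference = solve 6 (λ a b β₁ β₂ β₁' β₂' →
      ((⊝ b) :* (β₁ :- β₁') :+ a :* (β₂ :- β₂'))
        ⊜ (((⊝ b) :* β₁ :+ a :* β₂) :- ((⊝ b) :* β₁' :+ a :* β₂'))) refl
    x⊖x≡𝟘 : ∀ x → x ⊖ x ≡ 𝟘
    x⊖x≡𝟘 = solve 1 (λ x → (x :- x) ⊜ Κ 𝟘) refl
    difference-in-kernel : (⊖ α₄) ⊗ (β₁ ⊖ β₁') ⊕ α₃ ⊗ (β₂ ⊖ β₂') ≡ 𝟘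
    difference-in-kernel = trans (det-difference α₃ α₄ β₁ β₂ β₁' β₂')
      (trans (cong (_⊖ det (β₁' , β₂')) det≡) (x⊖x≡𝟘 (det (β₁' , β₂'))))
    multiple = det≡𝟘⇒proportional p q α₃ α₄ (β₁ ⊖ β₁') (β₂ ⊖ β₂') pα₃+qα₄≡𝟙 difference-in-kernel
    u≡γα₃ = proj₁ multiple
    w≡γα₄ = proj₂ multiple

  vv-translate : ∀ β₁ β₂ n m →
    (vv β₁ β₂ +ᵛ (n ·ᵛ v₁)) +ᵛ (m ·ᵛ v₂) ≡ vv (β₁ ⊕ (n + m √2) ⊗ α₃) (β₂ ⊕ (n + m √2) ⊗ α₄)
  vv-translate β₁ β₂ n m =
    cong₂ _,_ (coordinate β₁ α₃) (cong₂ _,_ (coordinate β₂ α₄)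
      (cong₂ _,_ (σ-coordinate β₁ α₃) (σ-coordinate β₂ α₄)))
    where
    coordinate : ∀ β α → (β ⊕ fromℤ n ⊗ α) ⊕ fromℤ m ⊗ (√2 ⊗ α) ≡ β ⊕ (n + m √2) ⊗ α
    coordinate β α = trans (translate β α √2 (fromℤ n) (fromℤ m))
                           (cong (λ γ → β ⊕ γ ⊗ α) (sym (+√2≡fromℤ⊕fromℤ⊗√2 n m)))
    σ-coordinate : ∀ β α → (σ β ⊕ fromℤ n ⊗ σ α) ⊕ fromℤ m ⊗ σ (√2 ⊗ α) ≡ σ (β ⊕ (n + m √2) ⊗ α)
    σ-coordinate β α = trans (sym (σ-translate β α (√2 ⊗ α) n m)) (cong σ (coordinate β α))

  ∈𝓛-vv⇔ : ∀ x β₁ β₂ → x ∈𝓛 vv β₁ β₂ ⇔ (∃[ δ₁ ] ∃[ δ₂ ] (x ≡ vv δ₁ δ₂ × (δ₁ , δ₂) ≋ (β₁ , β₂)))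
  ∈𝓛-vv⇔ x β₁ β₂ = mk⇔ to from
    where
    to : x ∈𝓛 vv β₁ β₂ → ∃[ δ₁ ] ∃[ δ₂ ] (x ≡ vv δ₁ δ₂ × (δ₁ , δ₂) ≋ (β₁ , β₂))
    to (n , m , x≡) = let γ = n + m √2 in
      β₁ ⊕ γ ⊗ α₃ , β₂ ⊕ γ ⊗ α₄ , trans x≡ (vv-translate β₁ β₂ n m) , γ , refl , refl
    from : ∃[ δ₁ ] ∃[ δ₂ ] (x ≡ vv δ₁ δ₂ × (δ₁ , δ₂) ≋ (β₁ , β₂)) → x ∈𝓛 vv β₁ β₂
    from (δ₁ , δ₂ , x≡vvδ , γ , δ₁≡ , δ₂≡) =
      re γ , im γ , trans x≡vvδ (trans (cong₂ vv δ₁≡ δ₂≡) (sym (vv-translate β₁ β₂ (re γ) (im γ))))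

  vv-injective : ∀ a b c d → vv a b ≡ vv c d → a ≡ c × b ≡ d
  vv-injective _ _ _ _ vvab≡vvcd = cong proj₁ vvab≡vvcd , cong (proj₁ ∘ proj₂) vvab≡vvcd

  vv∈𝓛vv⇔≋ : ∀ β₁ β₂ β₁' β₂' → vv β₁ β₂ ∈𝓛 vv β₁' β₂' ⇔ (β₁ , β₂) ≋ (β₁' , β₂')
  vv∈𝓛vv⇔≋ β₁ β₂ β₁' β₂' = mk⇔ to from
    where
    to : vv β₁ β₂ ∈𝓛 vv β₁' β₂' → (β₁ , β₂) ≋ (β₁' , β₂')
    to vvβ∈𝓛 =
      let δ₁ , δ₂ , vvβ≡vvδ , δ≋β' = Equivalence.to (∈𝓛-vv⇔ (vv β₁ β₂) β₁' β₂') vvβ∈𝓛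
          β₁≡δ₁ , β₂≡δ₂ = vv-injective β₁ β₂ δ₁ δ₂ vvβ≡vvδ
      in subst₂ (λ a b → (a , b) ≋ (β₁' , β₂')) (sym β₁≡δ₁) (sym β₂≡δ₂) δ≋β'
    from : (β₁ , β₂) ≋ (β₁' , β₂') → vv β₁ β₂ ∈𝓛 vv β₁' β₂'
    from β≋β' = Equivalence.from (∈𝓛-vv⇔ (vv β₁ β₂) β₁' β₂') (β₁ , β₂ , refl , β≋β')

  ∈𝓛-resp-≋ : ∀ {x} β₁ β₂ β₁' β₂' → (β₁ , β₂) ≋ (β₁' , β₂') → x ∈𝓛 vv β₁ β₂ → x ∈𝓛 vv β₁' β₂'
  ∈𝓛-resp-≋ {x} β₁ β₂ β₁' β₂' β≋β' x∈𝓛 =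
    let δ₁ , δ₂ , x≡vvδ , δ≋β = Equivalence.to (∈𝓛-vv⇔ x β₁ β₂) x∈𝓛
        δ≋β' = ≋-trans (δ₁ , δ₂) (β₁ , β₂) (β₁' , β₂') δ≋β β≋β'
    in Equivalence.from (∈𝓛-vv⇔ x β₁' β₂') (δ₁ , δ₂ , x≡vvδ , δ≋β')

  ≐𝓛⇔≋ : ∀ β₁ β₂ β₁' β₂' → vv β₁ β₂ ≐𝓛 vv β₁' β₂' ⇔ (β₁ , β₂) ≋ (β₁' , β₂')
  ≐𝓛⇔≋ β₁ β₂ β₁' β₂' = mk⇔
    (λ 𝓛≐𝓛' → Equivalence.to (vv∈𝓛vv⇔≋ β₁ β₂ β₁' β₂')
      (Equivalence.to (𝓛≐𝓛' (vv β₁ β₂)) (Equivalence.from (vv∈𝓛vv⇔≋ β₁ β₂ β₁ β₂) (≋-refl (β₁ , β₂)))))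
    (λ β≋β' _ → mk⇔ (∈𝓛-resp-≋ β₁ β₂ β₁' β₂' β≋β')
                    (∈𝓛-resp-≋ β₁' β₂' β₁ β₂ (≋-sym (β₁ , β₂) (β₁' , β₂') β≋β')))

lemma4p15 : (α₃ α₄ : OK) → RelPrime α₃ α₄ → ¬ (α₃ ≡ 𝟘) →
    ((β₁ β₂ β₁' β₂' : OK) →
      Lattice._≐𝓛_ α₃ α₄ (vv β₁ β₂) (vv β₁' β₂')
        ⇔ ((⊖ α₄) ⊗ β₁ ⊕ α₃ ⊗ β₂ ≡ (⊖ α₄) ⊗ β₁' ⊕ α₃ ⊗ β₂'))
    × ((β₁ β₂ : OK) →
      Lattice._∈𝓛_ α₃ α₄ (vv β₁ β₂) (𝟘 , 𝟙 , 𝟘 , 𝟙)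
        ⇔ (∃[ γ ] (β₁ ≡ 𝟘 ⊕ γ ⊗ α₃ × β₂ ≡ 𝟙 ⊕ γ ⊗ α₄)))
lemma4p15 α₃ α₄ coprime _ =
  let p , q , pα₃+qα₄≡𝟙 = relPrime⇒xa+yb≡𝟙 α₃ α₄ coprime
  in (λ β₁ β₂ β₁' β₂' →
        mk⇔ (≋⇒det≡ α₃ α₄ (β₁ , β₂) (β₁' , β₂')) (det≡⇒≋ α₃ α₄ p q (β₁ , β₂) (β₁' , β₂') pα₃+qα₄≡𝟙)
          ⇔-∘ ≐𝓛⇔≋ α₃ α₄ β₁ β₂ β₁' β₂')
   , (λ β₁ β₂ → vv∈𝓛vv⇔≋ α₃ α₄ β₁ β₂ 𝟘 𝟙)
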